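{- Let $G$ be a finite simple graph and let $M$ be a matching without common neighbors of $G$. If $P$ is an $M$-good path, then $P$ is an $M$-alternating path of length at most $3$ in which at most one edge belongs to $M$.
   Context: A matching is a set of pairwise disjoint edges. For an edge $e$, $I(e)$ is the set of edges other than $e$ sharing a vertex with $e$; $M$ is without common neighbors if $I(e)\cap I(f)=\emptyset$ for all distinct $e,f\in M$. A vertex is $M$-saturated if some edge of $M$ is incident to it. A path $v_1\dots v_{k+1}$ ($k\ge1$, distinct vertices) has length $k$, pendant edges its first and last edges, and pendant vertices $v_1,v_{k+1}$. It is $M$-alternating if of any two consecutive edges exactly one is in $M$. An $M$-alternating path is $M$-good if either both pendant edges are in $M$, or both pendant vertices are $M$-unsaturated, or one pendant edge is in $M$ and one pendant vertex is $M$-unsaturated. -}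

module Defs where

open import Data.Nat using (ℕ; suc; _≤_)
open import Data.Fin using (Fin)
open import Data.List using (List; []; _∷_; length; lookup)
open import Data.List.Relation.Unary.Unique.Propositional using (Unique)
open import Data.Product using (_×_; _,_; ∃)
open import Data.Sum using (_⊎_)
open import Data.Unit using (⊤)
open import Data.Empty using (⊥)
open import Relation.Nullary using (¬_)
open import Relation.Binary.PropositionalEquality using (_≡_; _≢_)

record SimpleGraph (n : ℕ) : Set₁ where
  field
    Adj     : Fin n → Fin n → Set
    sym     : ∀ {u v} → Adj u v → Adj v u
    irrefl  : ∀ {u} → ¬ Adj u u

module _ {n : ℕ} (G : SimpleGraph n) where
  open SimpleGraph G

  V : Set
  V = Fin n

  -- an (unordered) edge is represented by an ordered pair of its endpoints
  Edge : Set
  Edge = V × V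

  IsEdge : Edge → Set
  IsEdge (u , v) = Adj u v

  SameEdge : Edge → Edge → Set
  SameEdge (a , b) (c , d) = (a ≡ c × b ≡ d) ⊎ (a ≡ d × b ≡ c)

  ShareVertex : Edge → Edge → Set
  ShareVertex (a , b) (c , d) = a ≡ c ⊎ a ≡ d ⊎ b ≡ c ⊎ b ≡ d

  InI : Edge → Edge → Set
  InI e g = IsEdge g × ¬ SameEdge g e × ShareVertex g e

  record EdgeSet : Set₁ where
    field
      mem      : Edge → Set
      mem-sym  : ∀ {u v} → mem (u , v) → mem (v , u)
      mem-edge : ∀ {e} → mem e → IsEdge e

  open EdgeSet public

  IsMatching : EdgeSet → Set
  IsMatching M = ∀ e f → mem M e → mem M f → ¬ SameEdge e f → ¬ ShareVertex e f

  NoCommonNeighbors : EdgeSet → Set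
  NoCommonNeighbors M =
    ∀ e f → mem M e → mem M f → ¬ SameEdge e f → ∀ g → ¬ (InI e g × InI f g)

  Saturated : EdgeSet → V → Set
  Saturated M x = ∃ λ y → mem M (x , y)

  Unsaturated : EdgeSet → V → Set
  Unsaturated M x = ¬ Saturated M x

  -- Paths are given as lists of vertices v₁ ∷ v₂ ∷ rest (so at least one edge).
  -- consecutive edges of a vertex list
  edges : List V → List Edge
  edges (a ∷ b ∷ r) = (a , b) ∷ edges (b ∷ r)
  edges _ = []

  ConsecAdj : List V → Set
  ConsecAdj (a ∷ b ∷ r) = Adj a b × ConsecAdj (b ∷ r)
  ConsecAdj _ = ⊤

  IsPath : List V → Set
  IsPath p = Unique p × ConsecAdj p

  pathLength : List V → ℕ
  pathLength p = length (edges p)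

  lastVertex : V → List V → V
  lastVertex b [] = b
  lastVertex b (c ∷ r) = lastVertex c r

  lastEdge : V → V → List V → Edge
  lastEdge a b [] = (a , b)
  lastEdge a b (c ∷ r) = lastEdge b c r

  Alternating : EdgeSet → List V → Set
  Alternating M (a ∷ b ∷ c ∷ r) =
    ((mem M (a , b) × ¬ mem M (b , c)) ⊎ (¬ mem M (a , b) × mem M (b , c)))
    × Alternating M (b ∷ c ∷ r)
  Alternating M _ = ⊤

  IsGood : EdgeSet → V → V → List V → Set
  IsGood M v₁ v₂ rest =
    IsPath (v₁ ∷ v₂ ∷ rest) × Alternating M (v₁ ∷ v₂ ∷ rest) ×
    (  (mem M (v₁ , v₂) × mem M (lastEdge v₁ v₂ rest))
     ⊎ (Unsaturated M v₁ × Unsaturated M (lastVertex v₂ rest))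
     ⊎ (mem M (v₁ , v₂) × Unsaturated M (lastVertex v₂ rest))
     ⊎ (Unsaturated M v₁ × mem M (lastEdge v₁ v₂ rest)))

  AtMostOneInM : EdgeSet → List V → Set
  AtMostOneInM M p =
    (i j : Fin (length (edges p))) → i ≢ j →
    mem M (lookup (edges p) i) → mem M (lookup (edges p) j) → ⊥

-- Let M have no common neighbours
-- and let a b c d be a walk with ab, cd ∈ M and bc ∉ M.  Then bc lies in both
-- I(ab) and I(cd), which is impossible.  So an M-alternating path never shows
-- the edge pattern "in M, not in M, in M".  Consequently:
--
--   * the first edge of an alternating path with at least three edges is not
--     in M (otherwise its first three edges would have that pattern);
--   * an alternating path has at most three edges, since with four edges
--     either the path or its tail would start with an M-edge;
--   * an alternating path has at most one M-edge, by induction along the path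
--     (it starts with a non-M edge, or it is an M-edge followed by one
--     non-M edge).
--
-- The theorem only uses that a good path is alternating and that consecutive
-- vertices are adjacent; both are part of being M-good.
module Submission where

open import Defs
open import Data.Nat using (ℕ; _≤_; z≤n; s≤s)
open import Data.List using (List; []; _∷_; lookup)
open import Data.Product using (_×_; _,_)
open import Data.Sum using (inj₁; inj₂)
open import Data.Fin using (Fin; zero; suc)
open import Data.Empty using (⊥)
open import Relation.Nullary using (¬_; contradiction)
open import Relation.Binary.PropositionalEquality using (refl)

module _ {n : ℕ} {G : SimpleGraph n} (M : EdgeSet G) where
  open SimpleGraph G using (Adj; irrefl)

  NoneInM : List (Fin n) → Set
  NoneInM p = ∀ i → ¬ mem M (lookup (edges G p) i)

  none-cons : ∀ {a b r} → ¬ mem M (a , b) → NoneInM (b ∷ r) → NoneInM (a ∷ b ∷ r)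
  none-cons ab∉M _     zero    = ab∉M
  none-cons _    rest∉ (suc i) = rest∉ i

  none-vertex : ∀ {a} → NoneInM (a ∷ [])
  none-vertex ()

  atMostOne-skip : ∀ {a b r} → ¬ mem M (a , b) →
    AtMostOneInM G M (b ∷ r) → AtMostOneInM G M (a ∷ b ∷ r)
  atMostOne-skip _    _    zero    zero    i≢j _   _   = i≢j refl
  atMostOne-skip ab∉M _    zero    (suc _) _   ab∈ _   = ab∉M ab∈
  atMostOne-skip ab∉M _    (suc _) zero    _   _   ab∈ = ab∉M ab∈
  atMostOne-skip _    tail (suc i) (suc j) i≢j = tail i j (λ { refl → i≢j refl })

  atMostOne-first : ∀ {a b r} → NoneInM (b ∷ r) → AtMostOneInM G M (a ∷ b ∷ r)
  atMostOne-first _     zero    zero    i≢j _ _  = i≢j refl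
  atMostOne-first rest∉ zero    (suc j) _   _ j∈ = rest∉ j j∈
  atMostOne-first rest∉ (suc i) _       _   i∈ _ = rest∉ i i∈

  alternate-out : ∀ {a b c r} → Alternating G M (a ∷ b ∷ c ∷ r) →
    mem M (a , b) → ¬ mem M (b , c)
  alternate-out (inj₁ (_ , bc∉M) , _) _    = bc∉M
  alternate-out (inj₂ (ab∉M , _) , _) ab∈M = contradiction ab∈M ab∉M

  alternate-in : ∀ {a b c r} → Alternating G M (a ∷ b ∷ c ∷ r) →
    ¬ mem M (a , b) → mem M (b , c)
  alternate-in (inj₁ (ab∈M , _) , _) ab∉M = contradiction ab∈M ab∉M
  alternate-in (inj₂ (_ , bc∈M) , _) _    = bc∈M

  module _ (noCommon : NoCommonNeighbors G M) where

    -- Key fact: edges ab, cd ∈ M cannot be joined by an edge bc ∉ M, since bc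
    -- would lie in I(ab) ∩ I(cd).  The two M-edges are distinct: cd = ab as
    -- ordered pairs would put ba ∈ M equal to bc, and cd = ba would make bc a loop.
    no-MNM : ∀ {a b c d} → Adj b c →
      mem M (a , b) → ¬ mem M (b , c) → mem M (c , d) → ⊥
    no-MNM {a} {b} {c} {d} bc ab∈M bc∉M cd∈M =
      noCommon (a , b) (c , d) ab∈M cd∈M ab≠cd (b , c)
        ( (bc , bc≠ab , inj₂ (inj₁ refl))
        , (bc , bc≠cd , inj₂ (inj₂ (inj₁ refl))) )
      where
      ab≠cd : ¬ SameEdge G (a , b) (c , d)
      ab≠cd (inj₁ (refl , refl)) = bc∉M (mem-sym M ab∈M)
      ab≠cd (inj₂ (refl , refl)) = irrefl bc
      bc≠ab : ¬ SameEdge G (b , c) (a , b)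
      bc≠ab (inj₁ (refl , refl)) = bc∉M ab∈M
      bc≠ab (inj₂ (refl , refl)) = bc∉M (mem-sym M ab∈M)
      bc≠cd : ¬ SameEdge G (b , c) (c , d)
      bc≠cd (inj₁ (refl , refl)) = bc∉M cd∈M
      bc≠cd (inj₂ (refl , refl)) = bc∉M (mem-sym M cd∈M)

    -- In an alternating walk with at least three edges the first edge is not
    -- in M: otherwise the first three edges would read M, non-M, M.
    first-unmatched : ∀ {a b c d r} → ConsecAdj G (a ∷ b ∷ c ∷ d ∷ r) →
      Alternating G M (a ∷ b ∷ c ∷ d ∷ r) → ¬ mem M (a , b)
    first-unmatched (_ , bc , _) alt@(_ , alt′) ab∈M =
      no-MNM bc ab∈M bc∉M (alternate-in alt′ bc∉M)
      where bc∉M = alternate-out alt ab∈M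

    -- An alternating walk has at most four vertices: with five, both the walk
    -- and its tail would have to start with a non-M edge, against alternation.
    no-five-vertices : ∀ {a b c d e r} → ConsecAdj G (a ∷ b ∷ c ∷ d ∷ e ∷ r) →
      ¬ Alternating G M (a ∷ b ∷ c ∷ d ∷ e ∷ r)
    no-five-vertices adj@(_ , adj′) alt@(_ , alt′) =
      first-unmatched adj′ alt′ (alternate-in alt (first-unmatched adj alt))

    alternating-short : ∀ p → ConsecAdj G p → Alternating G M p → pathLength G p ≤ 3
    alternating-short []                    _   _   = z≤n
    alternating-short (_ ∷ [])              _   _   = z≤n
    alternating-short (_ ∷ _ ∷ [])          _   _   = s≤s z≤n
    alternating-short (_ ∷ _ ∷ _ ∷ [])      _   _   = s≤s (s≤s z≤n)
    alternating-short (_ ∷ _ ∷ _ ∷ _ ∷ [])  _   _   = s≤s (s≤s (s≤s z≤n))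
    alternating-short (_ ∷ _ ∷ _ ∷ _ ∷ _ ∷ _) adj alt = contradiction alt (no-five-vertices adj)

    -- Either it starts outside M
    -- (and we recurse on the tail), or it starts with an M-edge, which by
    -- first-unmatched is followed by a single edge, outside M.
    alternating-atMostOne : ∀ p → ConsecAdj G p → Alternating G M p → AtMostOneInM G M p
    alternating-atMostOne []          _ _ ()
    alternating-atMostOne (_ ∷ [])    _ _ ()
    alternating-atMostOne (_ ∷ b ∷ [])  _ _ = atMostOne-first {r = []} (none-vertex {b})
    alternating-atMostOne (_ ∷ b ∷ c ∷ r) (_ , adj) (inj₂ (ab∉M , _) , alt′) =
      atMostOne-skip ab∉M (alternating-atMostOne (b ∷ c ∷ r) adj alt′)
    alternating-atMostOne (_ ∷ b ∷ c ∷ []) _ (inj₁ (_ , bc∉M) , _) =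
      atMostOne-first {r = c ∷ []} (none-cons {r = []} bc∉M (none-vertex {c}))
    alternating-atMostOne (_ ∷ _ ∷ _ ∷ _ ∷ _) adj alt@(inj₁ (ab∈M , _) , _) =
      contradiction ab∈M (first-unmatched adj alt)

lemma2p5 : {n : ℕ} (G : SimpleGraph n) (M : EdgeSet G) →
    IsMatching G M → NoCommonNeighbors G M →
    (v₁ v₂ : Fin n) (rest : List (Fin n)) →
    IsGood G M v₁ v₂ rest →
    Alternating G M (v₁ ∷ v₂ ∷ rest) × pathLength G (v₁ ∷ v₂ ∷ rest) ≤ 3 ×
    AtMostOneInM G M (v₁ ∷ v₂ ∷ rest)
lemma2p5 G M _ noCommon v₁ v₂ rest ((_ , adj) , alt , _) =
  alt , alternating-short M noCommon p adj alt , alternating-atMostOne M noCommon p adj alt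
  where p = v₁ ∷ v₂ ∷ rest
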